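{- If $G$ is distance critical, then $G$ has no dominating vertex (a vertex adjacent to all other vertices).
   Context: All graphs are finite, simple and undirected. For vertices $x,y$ of a graph $G$, $d_G(x,y)$ is the length of a shortest path from $x$ to $y$ in $G$ ($\infty$ if none exists). A graph $G$ is distance critical if for every vertex $v \in V(G)$ there exist vertices $x,y \in V(G)\setminus\{v\}$ with $d_G(x,y) \neq d_{G-v}(x,y)$. -}

module Defs where

open import Data.Nat using (ℕ; zero; suc; _<_)
open import Data.Fin using (Fin; punchIn)
open import Data.Maybe using (Maybe; just; nothing)
open import Data.Product using (Σ; ∃; _×_)
open import Data.Empty using (⊥)
open import Data.Unit using (⊤)
open import Relation.Nullary using (¬_)
open import Relation.Binary.PropositionalEquality using (_≡_; _≢_)
open import Level using (0ℓ)

record Graph (n : ℕ) : Set₁ where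
  field
    Adj    : Fin n → Fin n → Set
    sym    : ∀ {x y} → Adj x y → Adj y x
    irrefl : ∀ {x} → ¬ Adj x x
open Graph public

data Walk {n : ℕ} (G : Graph n) : Fin n → Fin n → ℕ → Set where
  nil  : ∀ {x} → Walk G x x 0
  cons : ∀ {x y z k} → Adj G x y → Walk G y z k → Walk G x z (suc k)

-- Extended naturals ℕ ∪ {∞}: just k = k, nothing = ∞.
ℕ∞ : Set
ℕ∞ = Maybe ℕ

-- Dist G x y d : d is the distance d_G(x,y) (length of a shortest path,
-- ∞ if no path exists). Shortest walk length = shortest path length.
Dist : {n : ℕ} → Graph n → Fin n → Fin n → ℕ∞ → Set
Dist G x y (just k) = Walk G x y k × (∀ j → j < k → ¬ Walk G x y j)
Dist G x y nothing  = ∀ k → ¬ Walk G x y k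

-- G - v : delete vertex v; the remaining vertices Fin m are embedded
-- into Fin (suc m) by punchIn v (an order-preserving bijection onto V(G) ∖ {v}).
_─_ : {m : ℕ} → Graph (suc m) → Fin (suc m) → Graph m
Adj    (G ─ v) i j = Adj G (punchIn v i) (punchIn v j)
sym    (G ─ v) = sym G
irrefl (G ─ v) = irrefl G

DistChanges : {m : ℕ} → Graph (suc m) → Fin (suc m) → Fin m → Fin m → Set
DistChanges G v x y =
  Σ ℕ∞ λ d₁ → Σ ℕ∞ λ d₂ →
    Dist G (punchIn v x) (punchIn v y) d₁ × Dist (G ─ v) x y d₂ × d₁ ≢ d₂

DistanceCritical : {n : ℕ} → Graph n → Set
DistanceCritical {zero}  G = ⊤
DistanceCritical {suc m} G = ∀ v → Σ (Fin m) λ x → Σ (Fin m) λ y → DistChanges G v x y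

Dominating : {n : ℕ} → Graph n → Fin n → Set
Dominating G v = ∀ u → u ≢ v → Adj G v u

HasDominatingVertex : {n : ℕ} → Graph n → Set
HasDominatingVertex G = ∃ λ v → Dominating G v

-- If u dominates G, every distance in G is 0, 1 or 2 (the last via u), and which
-- one is decided by equality and adjacency alone.  Deleting a vertex w ≠ u keeps
-- u dominating, so distances in G − w are decided by the same data and nothing
-- changes: w is not distance critical.  Such a w exists because criticality at u
-- already names a vertex other than u.  Adjacency is not decidable, but the goal
-- is a negation, so excluded middle for it is available under ¬¬.
module Submission where

open import Defs
open import Data.Nat using (ℕ; zero; suc; _<_; s≤s)
open import Data.Nat.Properties using (<-cmp)
open import Data.Fin using (punchIn; punchOut; _≟_)
open import Data.Fin.Properties using (punchInᵢ≢i; punchIn-injective; punchIn-punchOut)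
open import Data.Maybe using (just; nothing)
open import Data.Product using (_,_; proj₁)
open import Data.Empty using (⊥-elim)
open import Function using (_∘_)
open import Relation.Binary using (tri<; tri≈; tri>)
open import Relation.Binary.PropositionalEquality
  using (_≡_; _≢_; refl; trans; subst) renaming (sym to ≡-sym)
open import Relation.Nullary using (¬_; Dec; yes; no)
open import Relation.Nullary.Decidable.Core using (¬¬-excluded-middle)

module _ {n : ℕ} {H : Graph n} where

  Dist-functional : ∀ {x y d e} → Dist H x y d → Dist H x y e → d ≡ e
  Dist-functional {d = just k} {just l} (wk , k-min) (wl , l-min) with <-cmp k l
  ... | tri< k<l _ _ = ⊥-elim (l-min k k<l wk)
  ... | tri≈ _ refl _ = refl
  ... | tri> _ _ l<k = ⊥-elim (k-min l l<k wl)
  Dist-functional {d = just k} {nothing} (wk , _) none = ⊥-elim (none k wk)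
  Dist-functional {d = nothing} {just l} none (wl , _) = ⊥-elim (none l wl)
  Dist-functional {d = nothing} {nothing} _ _ = refl

  Dist-self : ∀ {x} → Dist H x x (just 0)
  Dist-self = nil , λ _ ()

  Adj⇒Dist-1 : ∀ {x y} → x ≢ y → Adj H x y → Dist H x y (just 1)
  Adj⇒Dist-1 {x} {y} x≢y xy = cons xy nil , no-shorter
    where
    no-shorter : ∀ j → j < 1 → ¬ Walk H x y j
    no-shorter zero _ nil = x≢y refl
    no-shorter (suc _) (s≤s ()) _

  Dominating⇒Dist-2 : ∀ {u x y} → Dominating H u → x ≢ y → ¬ Adj H x y →
                      Dist H x y (just 2)
  Dominating⇒Dist-2 {u} {x} {y} dom x≢y ¬xy =
    cons (Graph.sym H (dom x x≢u)) (cons (dom y y≢u) nil) , no-shorter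
    where
    x≢u : x ≢ u
    x≢u refl = ¬xy (dom y (x≢y ∘ ≡-sym))
    y≢u : y ≢ u
    y≢u refl = ¬xy (Graph.sym H (dom x x≢y))
    no-shorter : ∀ j → j < 2 → ¬ Walk H x y j
    no-shorter zero _ nil = x≢y refl
    no-shorter (suc zero) _ (cons xy nil) = ¬xy xy
    no-shorter (suc (suc _)) (s≤s (s≤s ())) _

module _ {m : ℕ} (G : Graph (suc m)) where

  Dominating-─ : ∀ {u w} → Dominating G u → (w≢u : w ≢ u) →
                 Dominating (G ─ w) (punchOut w≢u)
  Dominating-─ {u} {w} dom w≢u v v≢u′ =
    subst (λ z → Adj G z (punchIn w v)) (≡-sym (punchIn-punchOut w≢u))
      (dom (punchIn w v) (v≢u′ ∘ punchIn≡u⇒v≡u′))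
    where
    punchIn≡u⇒v≡u′ : punchIn w v ≡ u → v ≡ punchOut w≢u
    punchIn≡u⇒v≡u′ e =
      punchIn-injective w v (punchOut w≢u) (trans e (≡-sym (punchIn-punchOut w≢u)))

  Dist-preserved⇒¬DistChanges : ∀ {w x y d} → Dist G (punchIn w x) (punchIn w y) d →
                                Dist (G ─ w) x y d → ¬ DistChanges G w x y
  Dist-preserved⇒¬DistChanges E₁ E₂ (_ , _ , D₁ , D₂ , d₁≢d₂) =
    d₁≢d₂ (trans (Dist-functional D₁ E₁) (≡-sym (Dist-functional D₂ E₂)))

  Dominating⇒¬DistChanges : ∀ {u w} → Dominating G u → w ≢ u → ∀ x y →
                            Dec (Adj (G ─ w) x y) → ¬ DistChanges G w x y
  Dominating⇒¬DistChanges {w = w} dom w≢u x y adj? with x ≟ y | adj?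
  ... | yes refl | _ = Dist-preserved⇒¬DistChanges Dist-self Dist-self
  ... | no x≢y | yes xy =
    Dist-preserved⇒¬DistChanges (Adj⇒Dist-1 (x≢y ∘ punchIn-injective w x y) xy)
                                (Adj⇒Dist-1 x≢y xy)
  ... | no x≢y | no ¬xy =
    Dist-preserved⇒¬DistChanges (Dominating⇒Dist-2 dom (x≢y ∘ punchIn-injective w x y) ¬xy)
                                (Dominating⇒Dist-2 (Dominating-─ dom w≢u) x≢y ¬xy)

lemma3p3 : (n : ℕ) (G : Graph n) → DistanceCritical G → ¬ HasDominatingVertex G
lemma3p3 zero G _ (() , _)
lemma3p3 (suc m) G critical (u , dom) =
  let w = punchIn u (proj₁ (critical u))
      (x , y , changes) = critical w
  in ¬¬-excluded-middle λ adj? →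
       Dominating⇒¬DistChanges G dom (punchInᵢ≢i u _) x y adj? changes
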